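{- Let $G$ be a Lehman graph of type $(3s-1,3,s)$ (so $k=1$), and let $e=w_Lb_R$ and $f=w_Rb_L$ be non-incident edges of $G$ ($w_L,w_R$ white, $b_L,b_R$ black). Suppose that $e$ and $f$ are edges of the auxiliary graph of $G$, that $\Gamma(b_L)\cap\Gamma(b_R)=\emptyset$, and that $\Gamma(w_L)\cap\Gamma(w_R)=\emptyset$. Then $G{\uparrow}\{e,f\}$ is a Lehman graph of type $(3(s+1)-1,3,s+1)$.
   Context: A bipartite graph $G$ with $n$ black and $n$ white vertices has bipartite adjacency matrix $A$ (rows indexed by black vertices, columns by white vertices, entry $1$ iff adjacent). A matrix is $r$-regular if all row and column sums equal $r$. $G$ is a Lehman graph of type $(n,r,s)$ if $A$ is $r$-regular and there is an $s$-regular $n\times n$ $(0,1)$-matrix $B$ with $AB^T=J+kI$, where $k=rs-n\in\{ -1,1,2,3,\ldots\}$, $J$ is the all-ones matrix and $I$ the identity. Such $B$ is unique; the mate $\Gamma(b)$ of a black vertex $b$ is $\{w: B(b,w)=1\}$ and the mate $\Gamma(w)$ of a white vertex $w$ is $\{b: B(b,w)=1\}$. The auxiliary graph of $G$ is the spanning subgraph whose edges are the edges $bw$ of $G$ with $B(b,w)=1$. For non-incident edges $e=w_Lb_R$, $f=w_Rb_L$, the graph $G{\uparrow}\{e,f\}$ is obtained from $G$ by deleting $e$ and $f$, adding new black vertices $b_0,b_1,b_2$ and white vertices $w_0,w_1,w_2$ with edges $b_0w_0,b_1w_1,b_2w_2,b_0w_1,b_2w_1,b_1w_0,b_1w_2$,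 and adding the edges $b_Lw_0$, $b_Rw_2$, $b_0w_L$, $b_2w_R$. -}

module Defs where

open import Data.Nat using (ℕ; zero; suc; _+_; _*_)
open import Data.Bool using (Bool; true; false; _∧_; not; if_then_else_)
open import Data.Fin using (Fin; zero; suc)
open import Data.Fin as F using ()
open import Data.Integer as ℤ using (ℤ; +_; -[1+_])
open import Data.Product using (Σ; _×_; ∃)
open import Relation.Nullary using (¬_)
open import Relation.Nullary.Decidable using (⌊_⌋)
open import Relation.Binary.PropositionalEquality using (_≡_; _≢_)

-- A square (0,1)-matrix of order n: rows indexed by black vertices,
-- columns by white vertices (true = 1, false = 0).
Mat : ℕ → Set
Mat n = Fin n → Fin n → Bool

b2n : Bool → ℕ
b2n true  = 1
b2n false = 0

Σ[_] : (n : ℕ) → (Fin n → ℕ) → ℕ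
Σ[ zero ] f = 0
Σ[ suc n ] f = f zero + Σ[ n ] (λ i → f (suc i))

Regular : (n r : ℕ) → Mat n → Set
Regular n r M = (∀ i → Σ[ n ] (λ j → b2n (M i j)) ≡ r)
              × (∀ j → Σ[ n ] (λ i → b2n (M i j)) ≡ r)

prodT : (n : ℕ) → Mat n → Mat n → Fin n → Fin n → ℕ
prodT n A B i j = Σ[ n ] (λ w → b2n (A i w ∧ B j w))

_==_ : {n : ℕ} → Fin n → Fin n → Bool
i == j = ⌊ i F.≟ j ⌋

kOf : (n r s : ℕ) → ℤ
kOf n r s = + (r * s) ℤ.- + n

IsJkI : (n : ℕ) → ℤ → Mat n → Mat n → Set
IsJkI n k A B = ∀ i j → + (prodT n A B i j) ≡ + 1 ℤ.+ (if i == j then k else + 0)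

LehmanPair : (n r s : ℕ) → Mat n → Mat n → Set
LehmanPair n r s A B =
  Regular n r A × Regular n s B
  × (kOf n r s ≢ + 0) × (-[1+ 0 ] ℤ.≤ kOf n r s)
  × IsJkI n (kOf n r s) A B

IsLehman : (n r s : ℕ) → Mat n → Set
IsLehman n r s A = ∃ λ (B : Mat n) → LehmanPair n r s A B

-- G↑{e,f} for e = w_L b_R, f = w_R b_L.
-- Vertices of the new graph on each side: Fin (3 + n);
-- black: 0,1,2 = b₀,b₁,b₂ and suc (suc (suc b)) = old b;
-- white: 0,1,2 = w₀,w₁,w₂ and suc (suc (suc w)) = old w.
up : {n : ℕ} → Mat n → (bL bR wL wR : Fin n) → Mat (3 + n)
up A bL bR wL wR zero zero = true
up A bL bR wL wR zero (suc zero) = true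
up A bL bR wL wR zero (suc (suc zero)) = false
up A bL bR wL wR (suc zero) zero = true
up A bL bR wL wR (suc zero) (suc zero) = true
up A bL bR wL wR (suc zero) (suc (suc zero)) = true
up A bL bR wL wR (suc (suc zero)) zero = false
up A bL bR wL wR (suc (suc zero)) (suc zero) = true
up A bL bR wL wR (suc (suc zero)) (suc (suc zero)) = true
up A bL bR wL wR zero (suc (suc (suc w))) = w == wL
up A bL bR wL wR (suc zero) (suc (suc (suc w))) = false
up A bL bR wL wR (suc (suc zero)) (suc (suc (suc w))) = w == wR
up A bL bR wL wR (suc (suc (suc b))) zero = b == bL
up A bL bR wL wR (suc (suc (suc b))) (suc zero) = false
up A bL bR wL wR (suc (suc (suc b))) (suc (suc zero)) = b == bR
up A bL bR wL wR (suc (suc (suc b))) (suc (suc (suc w))) =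
  A b w ∧ not ((b == bR) ∧ (w == wL)) ∧ not ((b == bL) ∧ (w == wR))

{-# OPTIONS --safe #-}
-- The mate B′ of G↑{e,f} is given explicitly and A′B′ᵀ = J + I is checked block by block.
-- An old row b of A′ is row b of A with the edges e, f deleted and the edges b_L w₀, b_R w₂
-- added; against the mate of an old vertex the two changes cancel exactly, so that block is
-- ABᵀ = J + I again.  Against the new mates one uses that Γ(b_L), Γ(b_R) and the remaining
-- n − 2s = s − 1 white vertices partition W (and dually for the columns), which also gives
-- the (s+1)-regularity of B′.
module Submission where

open import Defs
open import Data.Nat using (ℕ; zero; suc; _+_; _*_)
open import Data.Nat.Properties
  using (+-comm; +-assoc; +-identityʳ; +-cancelʳ-≡; *-suc; +-commutativeSemigroup)
open import Algebra.Properties.CommutativeSemigroup +-commutativeSemigroup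
  using (interchange; x∙yz≈zy∙x; x∙yz≈zx∙y)
open import Data.Nat.Tactic.RingSolver using (solve-∀)
open import Data.Bool using (Bool; true; false; _∧_; not; if_then_else_; T)
open import Data.Bool.Properties using (∧-zeroʳ; ∧-identityʳ)
open import Data.Fin using (Fin; zero; suc)
import Data.Fin as F
import Data.Integer as ℤ
import Data.Integer.Properties as ℤ
open import Data.Product using (_,_; proj₁; proj₂)
open import Data.Empty using (⊥-elim)
open import Function using (_∘_)
open import Relation.Nullary using (yes; no; contradiction)
open import Relation.Nullary.Decidable using (⌊⌋-map′)
open import Relation.Binary.PropositionalEquality
open ≡-Reasoning

Σ-cong : ∀ n {f g : Fin n → ℕ} → (∀ i → f i ≡ g i) → Σ[ n ] f ≡ Σ[ n ] g
Σ-cong zero    f≗g = refl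
Σ-cong (suc n) f≗g = cong₂ _+_ (f≗g zero) (Σ-cong n (λ i → f≗g (suc i)))

Σ-zero : ∀ n → Σ[ n ] (λ _ → 0) ≡ 0
Σ-zero zero    = refl
Σ-zero (suc n) = Σ-zero n

Σ-distrib-+ : ∀ n (f g : Fin n → ℕ) → Σ[ n ] (λ i → f i + g i) ≡ Σ[ n ] f + Σ[ n ] g
Σ-distrib-+ zero    f g = refl
Σ-distrib-+ (suc n) f g = begin
  f zero + g zero + Σ[ n ] (λ i → f (suc i) + g (suc i))
    ≡⟨ cong ((f zero + g zero) +_) (Σ-distrib-+ n (λ i → f (suc i)) (λ i → g (suc i))) ⟩
  f zero + g zero + (Σ[ n ] (λ i → f (suc i)) + Σ[ n ] (λ i → g (suc i)))
    ≡⟨ interchange (f zero) (g zero) _ _ ⟩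
  Σ[ suc n ] f + Σ[ suc n ] g ∎

Σ-distrib-+₃ : ∀ n (f g h : Fin n → ℕ) →
               Σ[ n ] (λ i → f i + g i + h i) ≡ Σ[ n ] f + Σ[ n ] g + Σ[ n ] h
Σ-distrib-+₃ n f g h =
  trans (Σ-distrib-+ n (λ i → f i + g i) h) (cong (_+ Σ[ n ] h) (Σ-distrib-+ n f g))

count : ∀ {n} → (Fin n → Bool) → ℕ
count {n} u = Σ[ n ] (λ i → b2n (u i))

-- prodT n A B i j is definitionally dot (A i) (B j).
dot : ∀ {n} → (Fin n → Bool) → (Fin n → Bool) → ℕ
dot u v = count (λ i → u i ∧ v i)

count-true : ∀ n → count {n} (λ _ → true) ≡ n
count-true zero    = refl
count-true (suc n) = cong suc (count-true n)

dot-trueʳ : ∀ {n} (u : Fin n → Bool) → dot u (λ _ → true) ≡ count u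
dot-trueʳ {n} u = Σ-cong n (λ i → cong b2n (∧-identityʳ (u i)))

==-suc : ∀ {n} (x y : Fin n) → (suc x == suc y) ≡ (x == y)
==-suc x y = ⌊⌋-map′ _ _ (x F.≟ y)

dot-== : ∀ {n} (x : Fin n) (g : Fin n → Bool) → dot (λ i → i == x) g ≡ b2n (g x)
dot-== {suc n} zero    g = trans (cong (b2n (g zero) +_) (Σ-zero n)) (+-identityʳ _)
dot-== {suc n} (suc x) g = begin
  Σ[ n ] (λ i → b2n ((suc i == suc x) ∧ g (suc i)))
    ≡⟨ Σ-cong n (λ i → cong (λ b → b2n (b ∧ g (suc i))) (==-suc i x)) ⟩
  dot (λ i → i == x) (λ i → g (suc i))
    ≡⟨ dot-== x (λ i → g (suc i)) ⟩
  b2n (g (suc x)) ∎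

count-== : ∀ {n} (x : Fin n) → count (λ i → i == x) ≡ 1
count-== x = trans (sym (dot-trueʳ (λ i → i == x))) (dot-== x (λ _ → true))

count-flag== : ∀ {n} c (x : Fin n) → count (λ i → c ∧ (i == x)) ≡ b2n c
count-flag== true  x = count-== x
count-flag== {n} false x = Σ-zero n

dot-flag== : ∀ {n} c (x : Fin n) (g : Fin n → Bool) →
             dot (λ i → c ∧ (i == x)) g ≡ b2n (c ∧ g x)
dot-flag== true  x g = dot-== x g
dot-flag== {n} false x g = Σ-zero n

b2n-∧-true : ∀ c {x} → x ≡ true → b2n (c ∧ x) ≡ b2n c
b2n-∧-true c refl = cong b2n (∧-identityʳ c)

b2n-∧-false : ∀ c {x} → x ≡ false → b2n (c ∧ x) ≡ 0
b2n-∧-false c refl = cong b2n (∧-zeroʳ c)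

∧-partition : ∀ a p q → p ∧ q ≡ false →
              b2n (a ∧ not p ∧ not q) + b2n (a ∧ p) + b2n (a ∧ q) ≡ b2n a
∧-partition false p     q     _ = refl
∧-partition true  false false _ = refl
∧-partition true  true  false _ = refl
∧-partition true  false true  _ = refl
∧-partition true  true  true  ()

indicator-partition : ∀ p q → p ∧ q ≡ false → b2n (not p ∧ not q) + b2n p + b2n q ≡ 1
indicator-partition = ∧-partition true

one-of-three : ∀ p q → p ∧ q ≡ false →
               ∀ X → b2n q + (b2n (not p ∧ not q) + (b2n p + X)) ≡ suc X
one-of-three false false _ X = refl
one-of-three false true  _ X = refl
one-of-three true  false _ X = refl
one-of-three true  true  () X

∧-delete : ∀ a e f c → (T e → T a) → (T f → T a) → e ∧ f ≡ false →
           b2n ((a ∧ not e ∧ not f) ∧ c) + b2n (e ∧ c) + b2n (f ∧ c) ≡ b2n (a ∧ c)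
∧-delete false false false c     _   _   _  = refl
∧-delete true  false false true  _   _   _  = refl
∧-delete true  false false false _   _   _  = refl
∧-delete true  true  false true  _   _   _  = refl
∧-delete true  true  false false _   _   _  = refl
∧-delete true  false true  c     _   _   _  = refl
∧-delete _     true  true  _     _   _   ()
∧-delete false true  false _     e⇒a _   _  = ⊥-elim (e⇒a _)
∧-delete false false true  _     _   f⇒a _  = ⊥-elim (f⇒a _)

dot-partition : ∀ {n} (a u v : Fin n → Bool) → (∀ i → u i ∧ v i ≡ false) →
                dot a (λ i → not (u i) ∧ not (v i)) + dot a u + dot a v ≡ count a
dot-partition {n} a u v u∩v = trans
  (sym (Σ-distrib-+₃ n _ _ _))
  (Σ-cong n (λ i → ∧-partition (a i) (u i) (v i) (u∩v i)))

dot-delete : ∀ {n} (a e f g : Fin n → Bool) →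
             (∀ i → T (e i) → T (a i)) → (∀ i → T (f i) → T (a i)) →
             (∀ i → e i ∧ f i ≡ false) →
             dot (λ i → a i ∧ not (e i) ∧ not (f i)) g + dot e g + dot f g ≡ dot a g
dot-delete {n} a e f g e⊆a f⊆a e∩f = trans
  (sym (Σ-distrib-+₃ n _ _ _))
  (Σ-cong n (λ i → ∧-delete (a i) (e i) (f i) (g i) (e⊆a i) (f⊆a i) (e∩f i)))

count-delete : ∀ {n} (a e f : Fin n → Bool) →
               (∀ i → T (e i) → T (a i)) → (∀ i → T (f i) → T (a i)) →
               (∀ i → e i ∧ f i ≡ false) →
               count (λ i → a i ∧ not (e i) ∧ not (f i)) + count e + count f ≡ count a
count-delete a e f e⊆a f⊆a e∩f = begin
  count a⁻ + count e + count f
    ≡˘⟨ cong₂ _+_ (cong₂ _+_ (dot-trueʳ a⁻) (dot-trueʳ e)) (dot-trueʳ f) ⟩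
  dot a⁻ true′ + dot e true′ + dot f true′
    ≡⟨ dot-delete a e f true′ e⊆a f⊆a e∩f ⟩
  dot a true′
    ≡⟨ dot-trueʳ a ⟩
  count a ∎
  where
  a⁻ true′ : Fin _ → Bool
  a⁻ i = a i ∧ not (e i) ∧ not (f i)
  true′ _ = true

count-neither : ∀ {n s} (u v : Fin n → Bool) → (∀ i → u i ∧ v i ≡ false) →
                count u ≡ s → count v ≡ s → n + 1 ≡ 3 * s →
                suc (count (λ i → not (u i) ∧ not (v i))) ≡ s
count-neither {n} {s} u v u∩v ∣u∣ ∣v∣ n+1≡3s = +-cancelʳ-≡ (s + s) _ s (begin
  suc m + (s + s)            ≡⟨ rearrange m s ⟩
  m + s + s + 1              ≡˘⟨ cong₂ (λ x y → m + x + y + 1) ∣u∣ ∣v∣ ⟩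
  m + count u + count v + 1  ≡⟨ cong (_+ 1) (dot-partition (λ _ → true) u v u∩v) ⟩
  count {n} (λ _ → true) + 1 ≡⟨ cong (_+ 1) (count-true n) ⟩
  n + 1                      ≡⟨ n+1≡3s ⟩
  3 * s                      ≡⟨ thrice s ⟩
  s + (s + s)                ∎)
  where
  m : ℕ
  m = count (λ i → not (u i) ∧ not (v i))
  rearrange : ∀ m s → suc m + (s + s) ≡ m + s + s + 1
  rearrange = solve-∀
  thrice : ∀ s → 3 * s ≡ s + (s + s)
  thrice = solve-∀

kOf-unit : ∀ {n r s} → n + 1 ≡ r * s → kOf n r s ≡ ℤ.+ 1
kOf-unit {n} {r} {s} n+1≡rs = begin
  ℤ.+ (r * s) ℤ.- ℤ.+ n         ≡˘⟨ cong (λ m → ℤ.+ m ℤ.- ℤ.+ n) n+1≡rs ⟩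
  ℤ.+ (n + 1) ℤ.- ℤ.+ n         ≡⟨ ℤ.[+m]-[+n]≡m⊖n (n + 1) n ⟩
  (n + 1) ℤ.⊖ n                 ≡˘⟨ cong ((n + 1) ℤ.⊖_) (+-identityʳ n) ⟩
  (n + 1) ℤ.⊖ (n + 0)           ≡⟨ ℤ.+-cancelˡ-⊖ n 1 0 ⟩
  ℤ.+ 1                         ∎

J+I-entry⇒ : ∀ c {m} → ℤ.+ m ≡ ℤ.+ 1 ℤ.+ (if c then ℤ.+ 1 else ℤ.+ 0) → m ≡ suc (b2n c)
J+I-entry⇒ true  = ℤ.+-injective
J+I-entry⇒ false = ℤ.+-injective

J+I-entry⇐ : ∀ c {m} → m ≡ suc (b2n c) → ℤ.+ m ≡ ℤ.+ 1 ℤ.+ (if c then ℤ.+ 1 else ℤ.+ 0)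
J+I-entry⇐ true  = cong (ℤ.+_)
J+I-entry⇐ false = cong (ℤ.+_)

LehmanPair⇒AB≡J+I : ∀ {n r s A B} → n + 1 ≡ r * s → LehmanPair n r s A B →
                   ∀ i j → prodT n A B i j ≡ suc (b2n (i == j))
LehmanPair⇒AB≡J+I {n} {r} {s} {A} {B} n+1≡rs (_ , _ , _ , _ , AB≡J+kI) i j =
  J+I-entry⇒ (i == j) (subst (λ k → IsJkI n k A B) (kOf-unit {n} {r} {s} n+1≡rs) AB≡J+kI i j)

AB≡J+I⇒LehmanPair : ∀ {n r s A B} → n + 1 ≡ r * s → Regular n r A → Regular n s B →
                   (∀ i j → prodT n A B i j ≡ suc (b2n (i == j))) → LehmanPair n r s A B
AB≡J+I⇒LehmanPair {n} {r} {s} {A} {B} n+1≡rs A-regular B-regular AB≡J+I =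
  A-regular , B-regular ,
  (λ k≡0 → contradiction (trans (sym k≡1) k≡0) λ ()) ,
  subst (ℤ.-[1+ 0 ] ℤ.≤_) (sym k≡1) ℤ.-≤+ ,
  subst (λ k → IsJkI n k A B) (sym k≡1) (λ i j → J+I-entry⇐ (i == j) (AB≡J+I i j))
  where
  k≡1 : kOf n r s ≡ ℤ.+ 1
  k≡1 = kOf-unit {n} {r} {s} n+1≡rs

module Up (s n : ℕ) (n+1≡3s : n + 1 ≡ 3 * s) (A B : Mat n)
  (A-regular : Regular n 3 A) (B-regular : Regular n s B)
  (AB≡J+I : ∀ b b′ → dot (A b) (B b′) ≡ suc (b2n (b == b′)))
  (bL bR wL wR : Fin n) (bL≢bR : bL ≢ bR)
  (e∈A : A bR wL ≡ true) (f∈A : A bL wR ≡ true)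
  (e∈B : B bR wL ≡ true) (f∈B : B bL wR ≡ true)
  (Γ-black-disjoint : ∀ w → B bL w ∧ B bR w ≡ false)
  (Γ-white-disjoint : ∀ b → B b wL ∧ B b wR ≡ false)
  where

  B-bL-wL : B bL wL ≡ false
  B-bL-wL =
    trans (sym (∧-identityʳ _)) (trans (cong (B bL wL ∧_) (sym e∈B)) (Γ-black-disjoint wL))

  B-bR-wR : B bR wR ≡ false
  B-bR-wR = trans (cong (_∧ B bR wR) (sym f∈B)) (Γ-black-disjoint wR)

  freeᵂ : Fin n → Bool
  freeᵂ w = not (B bL w) ∧ not (B bR w)

  freeᴮ : Fin n → Bool
  freeᴮ b = not (B b wL) ∧ not (B b wR)

  freeᵂ-wL : freeᵂ wL ≡ false
  freeᵂ-wL = trans (cong (λ x → not (B bL wL) ∧ not x) e∈B) (∧-zeroʳ _)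

  freeᵂ-wR : freeᵂ wR ≡ false
  freeᵂ-wR = cong (λ x → not x ∧ not (B bR wR)) f∈B

  e f : Mat n
  e b w = (b == bR) ∧ (w == wL)
  f b w = (b == bL) ∧ (w == wR)

  A⁻ : Mat n
  A⁻ b w = A b w ∧ not (e b w) ∧ not (f b w)

  e⊆A : ∀ b w → T (e b w) → T (A b w)
  e⊆A b w b=bR∧w=wL with b F.≟ bR | w F.≟ wL
  ... | yes refl | yes refl = subst T (sym e∈A) _
  ... | yes _    | no _     = ⊥-elim b=bR∧w=wL
  ... | no _     | _        = ⊥-elim b=bR∧w=wL

  f⊆A : ∀ b w → T (f b w) → T (A b w)
  f⊆A b w b=bL∧w=wR with b F.≟ bL | w F.≟ wR
  ... | yes refl | yes refl = subst T (sym f∈A) _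
  ... | yes _    | no _     = ⊥-elim b=bL∧w=wR
  ... | no _     | _        = ⊥-elim b=bL∧w=wR

  e∩f : ∀ b w → e b w ∧ f b w ≡ false
  e∩f b w with b F.≟ bR | b F.≟ bL
  ... | yes refl | yes bR≡bL = ⊥-elim (bL≢bR (sym bR≡bL))
  ... | yes _    | no _      = ∧-zeroʳ _
  ... | no _     | _         = refl

  A⁻-dot : ∀ b g →
    dot (A⁻ b) g + b2n ((b == bR) ∧ g wL) + b2n ((b == bL) ∧ g wR) ≡ dot (A b) g
  A⁻-dot b g = begin
    dot (A⁻ b) g + b2n ((b == bR) ∧ g wL) + b2n ((b == bL) ∧ g wR)
      ≡˘⟨ cong₂ (λ x y → dot (A⁻ b) g + x + y)
                (dot-flag== (b == bR) wL g) (dot-flag== (b == bL) wR g) ⟩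
    dot (A⁻ b) g + dot (e b) g + dot (f b) g
      ≡⟨ dot-delete (A b) (e b) (f b) g (e⊆A b) (f⊆A b) (e∩f b) ⟩
    dot (A b) g ∎

  A⁻-row-count : ∀ b → count (A⁻ b) + b2n (b == bR) + b2n (b == bL) ≡ 3
  A⁻-row-count b = begin
    count (A⁻ b) + b2n (b == bR) + b2n (b == bL)
      ≡˘⟨ cong₂ (λ x y → count (A⁻ b) + x + y)
                (count-flag== (b == bR) wL) (count-flag== (b == bL) wR) ⟩
    count (A⁻ b) + count (e b) + count (f b)
      ≡⟨ count-delete (A b) (e b) (f b) (e⊆A b) (f⊆A b) (e∩f b) ⟩
    count (A b)
      ≡⟨ proj₁ A-regular b ⟩
    3 ∎

  A⁻-column-count : ∀ w → count (λ b → A⁻ b w) + b2n (w == wL) + b2n (w == wR) ≡ 3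
  A⁻-column-count w = begin
    count (λ b → A⁻ b w) + b2n (w == wL) + b2n (w == wR)
      ≡˘⟨ cong₂ (λ x y → count (λ b → A⁻ b w) + x + y)
                (dot-== bR (λ _ → w == wL)) (dot-== bL (λ _ → w == wR)) ⟩
    count (λ b → A⁻ b w) + count (λ b → e b w) + count (λ b → f b w)
      ≡⟨ count-delete (λ b → A b w) (λ b → e b w) (λ b → f b w)
                      (λ b → e⊆A b w) (λ b → f⊆A b w) (λ b → e∩f b w) ⟩
    count (λ b → A b w)
      ≡⟨ proj₂ A-regular w ⟩
    3 ∎

  up-regular : Regular (3 + n) 3 (up A bL bR wL wR)
  up-regular = rows , columns
    where
    rows : ∀ b → Σ[ 3 + n ] (λ w → b2n (up A bL bR wL wR b w)) ≡ 3
    rows zero                = cong (2 +_) (count-== wL)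
    rows (suc zero)          = cong (3 +_) (Σ-zero n)
    rows (suc (suc zero))    = cong (2 +_) (count-== wR)
    rows (suc (suc (suc b))) =
      trans (x∙yz≈zy∙x (b2n (b == bL)) (b2n (b == bR)) (count (A⁻ b))) (A⁻-row-count b)

    columns : ∀ w → Σ[ 3 + n ] (λ b → b2n (up A bL bR wL wR b w)) ≡ 3
    columns zero                = cong (2 +_) (count-== bL)
    columns (suc zero)          = cong (3 +_) (Σ-zero n)
    columns (suc (suc zero))    = cong (2 +_) (count-== bR)
    columns (suc (suc (suc w))) =
      trans (x∙yz≈zx∙y (b2n (w == wL)) (b2n (w == wR)) (count (λ b → A⁻ b w)))
            (A⁻-column-count w)

  mate : Mat (3 + n)
  mate zero                zero                = false
  mate zero                (suc zero)          = true
  mate zero                (suc (suc zero))    = false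
  mate zero                (suc (suc (suc w))) = B bR w
  mate (suc zero)          zero                = true
  mate (suc zero)          (suc zero)          = false
  mate (suc zero)          (suc (suc zero))    = true
  mate (suc zero)          (suc (suc (suc w))) = freeᵂ w
  mate (suc (suc zero))    zero                = false
  mate (suc (suc zero))    (suc zero)          = true
  mate (suc (suc zero))    (suc (suc zero))    = false
  mate (suc (suc zero))    (suc (suc (suc w))) = B bL w
  mate (suc (suc (suc b))) zero                = B b wR
  mate (suc (suc (suc b))) (suc zero)          = freeᴮ b
  mate (suc (suc (suc b))) (suc (suc zero))    = B b wL
  mate (suc (suc (suc b))) (suc (suc (suc w))) = B b w

  mate-regular : Regular (3 + n) (suc s) mate
  mate-regular = rows , columns
    where
    rows : ∀ b → Σ[ 3 + n ] (λ w → b2n (mate b w)) ≡ suc s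
    rows zero                = cong suc (proj₁ B-regular bR)
    rows (suc zero)          =
      cong suc (count-neither (B bL) (B bR) Γ-black-disjoint
                              (proj₁ B-regular bL) (proj₁ B-regular bR) n+1≡3s)
    rows (suc (suc zero))    = cong suc (proj₁ B-regular bL)
    rows (suc (suc (suc b))) =
      trans (one-of-three (B b wL) (B b wR) (Γ-white-disjoint b) _) (cong suc (proj₁ B-regular b))

    columns : ∀ w → Σ[ 3 + n ] (λ b → b2n (mate b w)) ≡ suc s
    columns zero                = cong suc (proj₂ B-regular wR)
    columns (suc zero)          =
      cong suc (count-neither (λ b → B b wL) (λ b → B b wR) Γ-white-disjoint
                              (proj₂ B-regular wL) (proj₂ B-regular wR) n+1≡3s)
    columns (suc (suc zero))    = cong suc (proj₂ B-regular wL)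
    columns (suc (suc (suc w))) =
      trans (one-of-three (B bL w) (B bR w) (Γ-black-disjoint w) _) (cong suc (proj₂ B-regular w))

  A⁻-dot-B-bR : ∀ b → dot (A⁻ b) (B bR) ≡ 1
  A⁻-dot-B-bR b = +-cancelʳ-≡ (b2n (b == bR)) _ 1 (begin
    dot (A⁻ b) (B bR) + b2n (b == bR)
      ≡˘⟨ +-identityʳ _ ⟩
    dot (A⁻ b) (B bR) + b2n (b == bR) + 0
      ≡˘⟨ cong₂ (λ x y → dot (A⁻ b) (B bR) + x + y)
                (b2n-∧-true (b == bR) e∈B) (b2n-∧-false (b == bL) B-bR-wR) ⟩
    dot (A⁻ b) (B bR) + b2n ((b == bR) ∧ B bR wL) + b2n ((b == bL) ∧ B bR wR)
      ≡⟨ A⁻-dot b (B bR) ⟩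
    dot (A b) (B bR)
      ≡⟨ AB≡J+I b bR ⟩
    1 + b2n (b == bR) ∎)

  A⁻-dot-B-bL : ∀ b → dot (A⁻ b) (B bL) ≡ 1
  A⁻-dot-B-bL b = +-cancelʳ-≡ (b2n (b == bL)) _ 1 (begin
    dot (A⁻ b) (B bL) + b2n (b == bL)
      ≡˘⟨ cong (_+ b2n (b == bL)) (+-identityʳ _) ⟩
    dot (A⁻ b) (B bL) + 0 + b2n (b == bL)
      ≡˘⟨ cong₂ (λ x y → dot (A⁻ b) (B bL) + x + y)
                (b2n-∧-false (b == bR) B-bL-wL) (b2n-∧-true (b == bL) f∈B) ⟩
    dot (A⁻ b) (B bL) + b2n ((b == bR) ∧ B bL wL) + b2n ((b == bL) ∧ B bL wR)
      ≡⟨ A⁻-dot b (B bL) ⟩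
    dot (A b) (B bL)
      ≡⟨ AB≡J+I b bL ⟩
    1 + b2n (b == bL) ∎)

  A⁻-dot-freeᵂ : ∀ b → dot (A⁻ b) freeᵂ ≡ dot (A b) freeᵂ
  A⁻-dot-freeᵂ b = begin
    dot (A⁻ b) freeᵂ
      ≡˘⟨ trans (+-identityʳ _) (+-identityʳ _) ⟩
    dot (A⁻ b) freeᵂ + 0 + 0
      ≡˘⟨ cong₂ (λ x y → dot (A⁻ b) freeᵂ + x + y)
                (b2n-∧-false (b == bR) freeᵂ-wL) (b2n-∧-false (b == bL) freeᵂ-wR) ⟩
    dot (A⁻ b) freeᵂ + b2n ((b == bR) ∧ freeᵂ wL) + b2n ((b == bL) ∧ freeᵂ wR)
      ≡⟨ A⁻-dot b freeᵂ ⟩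
    dot (A b) freeᵂ ∎

  A-dot-freeᵂ : ∀ b → dot (A b) freeᵂ + suc (b2n (b == bL)) + suc (b2n (b == bR)) ≡ 3
  A-dot-freeᵂ b = begin
    dot (A b) freeᵂ + suc (b2n (b == bL)) + suc (b2n (b == bR))
      ≡˘⟨ cong₂ (λ x y → dot (A b) freeᵂ + x + y) (AB≡J+I b bL) (AB≡J+I b bR) ⟩
    dot (A b) freeᵂ + dot (A b) (B bL) + dot (A b) (B bR)
      ≡⟨ dot-partition (A b) (B bL) (B bR) Γ-black-disjoint ⟩
    count (A b)
      ≡⟨ proj₁ A-regular b ⟩
    3 ∎

  old-row-product-b₁ : ∀ b →
    b2n ((b == bL) ∧ true) + (b2n ((b == bR) ∧ true) + dot (A⁻ b) freeᵂ) ≡ 1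
  old-row-product-b₁ b = begin
    b2n ((b == bL) ∧ true) + (b2n ((b == bR) ∧ true) + dot (A⁻ b) freeᵂ)
      ≡⟨ cong₂ (λ x y → b2n x + (b2n y + dot (A⁻ b) freeᵂ))
               (∧-identityʳ (b == bL)) (∧-identityʳ (b == bR)) ⟩
    b2n (b == bL) + (b2n (b == bR) + dot (A⁻ b) freeᵂ)
      ≡⟨ cong (λ x → b2n (b == bL) + (b2n (b == bR) + x)) (A⁻-dot-freeᵂ b) ⟩
    b2n (b == bL) + (b2n (b == bR) + dot (A b) freeᵂ)
      ≡⟨ +-cancelʳ-≡ 2 _ 1 (trans (rearrange _ _ _) (A-dot-freeᵂ b)) ⟩
    1 ∎
    where
    rearrange : ∀ x a c → a + (c + x) + 2 ≡ x + suc a + suc c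
    rearrange = solve-∀

  old-row-product-old : ∀ b b′ →
    b2n ((b == bL) ∧ B b′ wR) + (b2n ((b == bR) ∧ B b′ wL) + dot (A⁻ b) (B b′))
    ≡ suc (b2n (b == b′))
  old-row-product-old b b′ = begin
    b2n ((b == bL) ∧ B b′ wR) + (b2n ((b == bR) ∧ B b′ wL) + dot (A⁻ b) (B b′))
      ≡⟨ x∙yz≈zy∙x (b2n ((b == bL) ∧ B b′ wR)) (b2n ((b == bR) ∧ B b′ wL))
                   (dot (A⁻ b) (B b′)) ⟩
    dot (A⁻ b) (B b′) + b2n ((b == bR) ∧ B b′ wL) + b2n ((b == bL) ∧ B b′ wR)
      ≡⟨ A⁻-dot b (B b′) ⟩
    dot (A b) (B b′)
      ≡⟨ AB≡J+I b b′ ⟩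
    suc (b2n (b == b′)) ∎

  up-mate-product : ∀ i j → prodT (3 + n) (up A bL bR wL wR) mate i j ≡ suc (b2n (i == j))
  up-mate-product zero zero                   = cong suc (trans (dot-== wL (B bR)) (cong b2n e∈B))
  up-mate-product zero (suc zero)             = cong suc (trans (dot-== wL freeᵂ) (cong b2n freeᵂ-wL))
  up-mate-product zero (suc (suc zero))       = cong suc (trans (dot-== wL (B bL)) (cong b2n B-bL-wL))
  up-mate-product zero (suc (suc (suc b)))    = begin
    b2n (B b wR) + (b2n (freeᴮ b) + dot (λ w → w == wL) (B b))
      ≡⟨ cong (λ x → b2n (B b wR) + (b2n (freeᴮ b) + x)) (dot-== wL (B b)) ⟩
    b2n (B b wR) + (b2n (freeᴮ b) + b2n (B b wL))
      ≡⟨ +-comm (b2n (B b wR)) _ ⟩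
    b2n (freeᴮ b) + b2n (B b wL) + b2n (B b wR)
      ≡⟨ indicator-partition (B b wL) (B b wR) (Γ-white-disjoint b) ⟩
    1 ∎
  up-mate-product (suc zero) zero             = cong suc (Σ-zero n)
  up-mate-product (suc zero) (suc zero)       = cong (2 +_) (Σ-zero n)
  up-mate-product (suc zero) (suc (suc zero)) = cong suc (Σ-zero n)
  up-mate-product (suc zero) (suc (suc (suc b))) =
    trans (one-of-three (B b wL) (B b wR) (Γ-white-disjoint b) _) (cong suc (Σ-zero n))
  up-mate-product (suc (suc zero)) zero          = cong suc (trans (dot-== wR (B bR)) (cong b2n B-bR-wR))
  up-mate-product (suc (suc zero)) (suc zero)    = cong suc (trans (dot-== wR freeᵂ) (cong b2n freeᵂ-wR))
  up-mate-product (suc (suc zero)) (suc (suc zero)) =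
    cong suc (trans (dot-== wR (B bL)) (cong b2n f∈B))
  up-mate-product (suc (suc zero)) (suc (suc (suc b))) = begin
    b2n (freeᴮ b) + (b2n (B b wL) + dot (λ w → w == wR) (B b))
      ≡⟨ cong (λ x → b2n (freeᴮ b) + (b2n (B b wL) + x)) (dot-== wR (B b)) ⟩
    b2n (freeᴮ b) + (b2n (B b wL) + b2n (B b wR))
      ≡˘⟨ +-assoc (b2n (freeᴮ b)) _ _ ⟩
    b2n (freeᴮ b) + b2n (B b wL) + b2n (B b wR)
      ≡⟨ indicator-partition (B b wL) (B b wR) (Γ-white-disjoint b) ⟩
    1 ∎
  up-mate-product (suc (suc (suc b))) zero =
    trans (cong₂ (λ x y → b2n x + (b2n y + dot (A⁻ b) (B bR)))
                 (∧-zeroʳ (b == bL)) (∧-zeroʳ (b == bR)))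
          (A⁻-dot-B-bR b)
  up-mate-product (suc (suc (suc b))) (suc zero) = old-row-product-b₁ b
  up-mate-product (suc (suc (suc b))) (suc (suc zero)) =
    trans (cong₂ (λ x y → b2n x + (b2n y + dot (A⁻ b) (B bL)))
                 (∧-zeroʳ (b == bL)) (∧-zeroʳ (b == bR)))
          (A⁻-dot-B-bL b)
  up-mate-product (suc (suc (suc b))) (suc (suc (suc b′))) =
    trans (old-row-product-old b b′)
          (cong (suc ∘ b2n) (sym (trans (==-suc _ _) (trans (==-suc _ _) (==-suc b b′)))))

proposition3p3 : (s n : ℕ) → n + 1 ≡ 3 * s →
    (A B : Mat n) → LehmanPair n 3 s A B →
    (bL bR wL wR : Fin n) →
    A bR wL ≡ true → A bL wR ≡ true →
    bL ≢ bR → wL ≢ wR →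
    B bR wL ≡ true → B bL wR ≡ true →
    (∀ w → (B bL w ∧ B bR w) ≡ false) →
    (∀ b → (B b wL ∧ B b wR) ≡ false) →
    IsLehman (3 + n) 3 (suc s) (up A bL bR wL wR)
proposition3p3 s n n+1≡3s A B pair@(A-regular , B-regular , _) bL bR wL wR
               e∈A f∈A bL≢bR _ e∈B f∈B Γ-black-disjoint Γ-white-disjoint =
  mate , AB≡J+I⇒LehmanPair {A = up A bL bR wL wR} {B = mate} 3+n+1≡3[1+s]
                          up-regular mate-regular up-mate-product
  where
  open Up s n n+1≡3s A B A-regular B-regular (LehmanPair⇒AB≡J+I n+1≡3s pair)
          bL bR wL wR bL≢bR e∈A f∈A e∈B f∈B Γ-black-disjoint Γ-white-disjoint
  3+n+1≡3[1+s] : 3 + n + 1 ≡ 3 * suc s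
  3+n+1≡3[1+s] = trans (cong (3 +_) n+1≡3s) (sym (*-suc 3 s))
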